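{- Let $n$ and $d$ be positive integers with $\gcd(n,(2^d)!)=1$. Then one can place $n^{d-1}$ pairwise nonattacking queens on distinct cells of $(\mathbb Z/n\mathbb Z)^d$.
   Context: Two queens at distinct positions $p,q\in(\mathbb Z/n\mathbb Z)^d$ attack each other if $q-p=c\mathbf v$ for some integer $c$ and some $\mathbf v\in\{ -1,0,1\}^d\setminus\{\mathbf 0\}$ (computed in $(\mathbb Z/n\mathbb Z)^d$); a set of queens is nonattacking if no two of them attack each other. -}

module Defs where

open import Data.Nat as ℕ using (ℕ; suc)
open import Data.Fin using (Fin; toℕ)
open import Data.Integer as ℤ using (ℤ; +_; -[1+_]; 0ℤ)
open import Data.Integer.Divisibility using () renaming (_∣_ to _∣ℤ_)
open import Data.Product using (Σ; ∃; _×_)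
open import Relation.Binary.PropositionalEquality using (_≡_)
open import Relation.Nullary using (¬_)

Cell : ℕ → ℕ → Set
Cell n d = Fin d → Fin n

data Sign : Set where
  neg zer pos : Sign

signℤ : Sign → ℤ
signℤ neg = -[1+ 0 ]
signℤ zer = 0ℤ
signℤ pos = + 1

NonzeroDir : ∀ {d} → (Fin d → Sign) → Set
NonzeroDir {d} v = ∃ λ i → ¬ (v i ≡ zer)

-- Queens at p, q attack iff q - p = c v in (ℤ/nℤ)^d for some integer c and
-- some nonzero v ∈ {-1,0,1}^d, i.e. n ∣ (q_i - p_i - c v_i) in ℤ for all i.
Attacks : ∀ {n d} → Cell n d → Cell n d → Set
Attacks {n} {d} p q =
  Σ ℤ λ c → Σ (Fin d → Sign) λ v → NonzeroDir v ×
    (∀ i → (+ n) ∣ℤ ((+ toℕ (q i)) ℤ.- (+ toℕ (p i)) ℤ.- c ℤ.* signℤ (v i)))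

NonattackingPlacement : (n d m : ℕ) → Set
NonattackingPlacement n d m =
  Σ (Fin m → Cell n d) λ Q →
    ∀ i j → ¬ (i ≡ j) → ¬ (Q i ≡ Q j) × ¬ Attacks (Q i) (Q j)

-- The queens are the cells x with x₀ + 2x₁ + 4x₂ + … + 2^(d-1)x_(d-1) ≡ 0 (mod n), one for each choice of
-- x₁,…,x_(d-1). If q - p = c v with v ∈ {-1,0,1}^d nonzero, the same weighted sum gives n ∣ c M where
-- M = Σ 2^i vᵢ. Signed binary digits make M nonzero, with |M| < 2^d, so |M| divides (2^d)! and is
-- coprime to n; hence n ∣ c, so q - p = c v ≡ 0 and p = q.

{-# OPTIONS --safe #-}
module Submission where

open import Defs
open import Data.Nat using (ℕ; suc; _^_; _∸_; _!; _≤_)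
open import Data.Nat.GCD using (gcd)
open import Relation.Binary.PropositionalEquality using (_≡_)

open import Data.Nat as ℕ using (NonZero; _<_; z≤n; s≤s)
import Data.Nat.Properties as ℕ
open import Data.Nat.Divisibility as ℕ using (m≤n⇒m!∣n!; ∣1⇒≡1; n∣m⇒m%n≡0)
open import Data.Nat.Coprimality using (Coprime; gcd≡1⇒coprime; coprime-divisor)
open import Data.Nat.DivMod using (m<n⇒m%n≡m)
open import Data.Fin using (Fin; zero; suc; toℕ; fromℕ<; combine; finToFun; funToFin)
open import Data.Fin.Properties using (toℕ-injective; toℕ<n; toℕ-fromℕ<; funToFin-finToFin)
open import Data.Integer as ℤ using (ℤ; +_; 0ℤ; ∣_∣; -_; _-_; _%ℕ_; _/ℕ_)
import Data.Integer.Properties as ℤ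
open import Data.Integer.Divisibility.Signed
  using (_∣_; divides; ∣-refl; ∣ᵤ⇒∣; ∣⇒∣ᵤ; ∣m∣n⇒∣m+n; ∣m∣n⇒∣m-n; ∣m+n∣n⇒∣m; ∣m⇒∣m*n; ∣n⇒∣m*n)
open import Data.Integer.DivMod using (n%ℕd<d; a≡a%ℕn+[a/ℕn]*n)
open import Data.Integer.Tactic.RingSolver using (solve-∀)
open import Data.Product using (_×_; _,_)
open import Function using (_∘_)
open import Relation.Binary.PropositionalEquality
  using (_≢_; _≗_; refl; sym; trans; cong; cong₂; cong-app; subst; module ≡-Reasoning)
open import Relation.Nullary using (¬_)

binary : ∀ {k} → (Fin k → ℤ) → ℤ
binary {ℕ.zero} x = 0ℤ
binary {suc k}  x = x zero ℤ.+ + 2 ℤ.* binary (x ∘ suc)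

binary-combination : ∀ {k} (x y u : Fin k → ℤ) c →
  binary (λ i → x i - y i - c ℤ.* u i) ≡ binary x - binary y - c ℤ.* binary u
binary-combination {ℕ.zero} _ _ _ c = cong (ℤ._-_ 0ℤ) (sym (ℤ.*-zeroʳ c))
binary-combination {suc k} x y u c = begin
  x₀ - y₀ - c ℤ.* u₀ ℤ.+ + 2 ℤ.* binary (λ i → x (suc i) - y (suc i) - c ℤ.* u (suc i))
    ≡⟨ cong (λ t → x₀ - y₀ - c ℤ.* u₀ ℤ.+ + 2 ℤ.* t) (binary-combination (x ∘ suc) (y ∘ suc) (u ∘ suc) c) ⟩
  x₀ - y₀ - c ℤ.* u₀ ℤ.+ + 2 ℤ.* (X - Y - c ℤ.* U)
    ≡⟨ regroup x₀ y₀ u₀ X Y U c ⟩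
  (x₀ ℤ.+ + 2 ℤ.* X) - (y₀ ℤ.+ + 2 ℤ.* Y) - c ℤ.* (u₀ ℤ.+ + 2 ℤ.* U) ∎
  where
  open ≡-Reasoning
  x₀ = x zero; y₀ = y zero; u₀ = u zero
  X = binary (x ∘ suc); Y = binary (y ∘ suc); U = binary (u ∘ suc)
  regroup : ∀ x₀ y₀ u₀ X Y U c →
    x₀ - y₀ - c ℤ.* u₀ ℤ.+ + 2 ℤ.* (X - Y - c ℤ.* U)
      ≡ (x₀ ℤ.+ + 2 ℤ.* X) - (y₀ ℤ.+ + 2 ℤ.* Y) - c ℤ.* (u₀ ℤ.+ + 2 ℤ.* U)
  regroup = solve-∀

∣-binary : ∀ {m k} {x : Fin k → ℤ} → (∀ i → m ∣ x i) → m ∣ binary x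
∣-binary {k = ℕ.zero} _   = divides 0ℤ refl
∣-binary {k = suc k}  m∣x = ∣m∣n⇒∣m+n (m∣x zero) (∣n⇒∣m*n (+ 2) (∣-binary (m∣x ∘ suc)))

∣signℤ∣≤1 : ∀ s → ∣ signℤ s ∣ ≤ 1
∣signℤ∣≤1 neg = s≤s z≤n
∣signℤ∣≤1 zer = z≤n
∣signℤ∣≤1 pos = s≤s z≤n

2∣signℤ⇒zer : ∀ s → + 2 ∣ signℤ s → s ≡ zer
2∣signℤ⇒zer neg 2∣-1 with () ← ∣1⇒≡1 (∣⇒∣ᵤ 2∣-1)
2∣signℤ⇒zer zer _    = refl
2∣signℤ⇒zer pos 2∣1  with () ← ∣1⇒≡1 (∣⇒∣ᵤ 2∣1)

-- Parity forces the lowest digit to vanish, and then the remaining digits sum to zero.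
binary-signs≡0⇒zer : ∀ {k} (v : Fin k → Sign) → binary (signℤ ∘ v) ≡ 0ℤ → ∀ i → v i ≡ zer
binary-signs≡0⇒zer {suc k} v M≡0 = λ where
    zero    → v₀≡zer
    (suc i) → binary-signs≡0⇒zer (v ∘ suc) M′≡0 i
  where
  M′ = binary (signℤ ∘ v ∘ suc)
  v₀≡zer : v zero ≡ zer
  v₀≡zer = 2∣signℤ⇒zer (v zero)
    (∣m+n∣n⇒∣m (subst (+ 2 ∣_) (sym M≡0) (divides 0ℤ refl)) (∣m⇒∣m*n M′ ∣-refl))
  2M′≡0 : + 2 ℤ.* M′ ≡ + 2 ℤ.* 0ℤ
  2M′≡0 = begin
    + 2 ℤ.* M′                         ≡⟨ ℤ.+-identityˡ _ ⟨
    signℤ zer ℤ.+ + 2 ℤ.* M′           ≡⟨ cong (λ s → signℤ s ℤ.+ + 2 ℤ.* M′) v₀≡zer ⟨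
    signℤ (v zero) ℤ.+ + 2 ℤ.* M′      ≡⟨ M≡0 ⟩
    0ℤ                                 ∎
    where open ≡-Reasoning
  M′≡0 : M′ ≡ 0ℤ
  M′≡0 = ℤ.*-cancelˡ-≡ (+ 2) M′ 0ℤ 2M′≡0

∣binary-signs∣<2^k : ∀ {k} (v : Fin k → Sign) → ∣ binary (signℤ ∘ v) ∣ < 2 ^ k
∣binary-signs∣<2^k {ℕ.zero} v = s≤s z≤n
∣binary-signs∣<2^k {suc k}  v = begin
  suc ∣ s ℤ.+ + 2 ℤ.* M′ ∣       ≤⟨ s≤s (ℤ.∣i+j∣≤∣i∣+∣j∣ s (+ 2 ℤ.* M′)) ⟩
  suc (∣ s ∣ ℕ.+ ∣ + 2 ℤ.* M′ ∣) ≡⟨ cong (λ t → suc (∣ s ∣ ℕ.+ t)) (ℤ.abs-* (+ 2) M′) ⟩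
  suc (∣ s ∣ ℕ.+ 2 ℕ.* ∣ M′ ∣)   ≤⟨ s≤s (ℕ.+-monoˡ-≤ (2 ℕ.* ∣ M′ ∣) (∣signℤ∣≤1 (v zero))) ⟩
  2 ℕ.+ 2 ℕ.* ∣ M′ ∣             ≡⟨ ℕ.*-suc 2 ∣ M′ ∣ ⟨
  2 ℕ.* suc ∣ M′ ∣               ≤⟨ ℕ.*-monoʳ-≤ 2 (∣binary-signs∣<2^k (v ∘ suc)) ⟩
  2 ℕ.* 2 ^ k                    ∎
  where
  open ℕ.≤-Reasoning
  s  = signℤ (v zero)
  M′ = binary (signℤ ∘ v ∘ suc)

m∣m! : ∀ {m} → 0 < m → m ℕ.∣ m !
m∣m! {suc m} _ = ℕ.m∣m*n (m !)

coprime-factorial⇒coprime : ∀ {n m a} → Coprime n (m !) → 0 < a → a ≤ m → Coprime n a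
coprime-factorial⇒coprime cop 0<a a≤m (d∣n , d∣a) =
  cop (d∣n , ℕ.∣-trans d∣a (ℕ.∣-trans (m∣m! 0<a) (m≤n⇒m!∣n! a≤m)))

∣c*binary-signs⇒∣c : ∀ {n d c} (v : Fin d → Sign) → Coprime n ((2 ^ d) !) → NonzeroDir v →
  + n ∣ c ℤ.* binary (signℤ ∘ v) → + n ∣ c
∣c*binary-signs⇒∣c {n} {c = c} v cop (i , vᵢ≢zer) n∣cM =
  ∣ᵤ⇒∣ (coprime-divisor cop-M (subst (n ℕ.∣_) ∣cM∣≡∣M∣∣c∣ (∣⇒∣ᵤ n∣cM)))
  where
  M = binary (signℤ ∘ v)
  0<∣M∣ : 0 < ∣ M ∣
  0<∣M∣ = ℕ.n≢0⇒n>0 (λ ∣M∣≡0 → vᵢ≢zer (binary-signs≡0⇒zer v (ℤ.∣i∣≡0⇒i≡0 ∣M∣≡0) i))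
  cop-M : Coprime n ∣ M ∣
  cop-M = coprime-factorial⇒coprime cop 0<∣M∣ (ℕ.<⇒≤ (∣binary-signs∣<2^k v))
  ∣cM∣≡∣M∣∣c∣ : ∣ c ℤ.* M ∣ ≡ ∣ M ∣ ℕ.* ∣ c ∣
  ∣cM∣≡∣M∣∣c∣ = trans (ℤ.abs-* c M) (ℕ.*-comm ∣ c ∣ ∣ M ∣)

∣toℕ-toℕ⇒≡ : ∀ {n} (a b : Fin n) → + n ∣ + toℕ a - + toℕ b → a ≡ b
∣toℕ-toℕ⇒≡ {suc n} a b n∣a-b = toℕ-injective (ℤ.+-injective (ℤ.i-j≡0⇒i≡j _ _ a-b≡0))
  where
  a-b = + toℕ a - + toℕ b
  ∣a-b∣<n : ∣ a-b ∣ < suc n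
  ∣a-b∣<n = ℕ.≤-<-trans
    (subst (λ z → ∣ z ∣ ≤ toℕ a ℕ.⊔ toℕ b) (sym (ℤ.m-n≡m⊖n (toℕ a) (toℕ b))) (ℤ.∣m⊝n∣≤m⊔n (toℕ a) (toℕ b)))
    (ℕ.⊔-lub (toℕ<n a) (toℕ<n b))
  a-b≡0 : a-b ≡ 0ℤ
  a-b≡0 = ℤ.∣i∣≡0⇒i≡0 (trans (sym (m<n⇒m%n≡m ∣a-b∣<n)) (n∣m⇒m%n≡0 _ _ (∣⇒∣ᵤ n∣a-b)))

residue : ∀ n .{{_ : NonZero n}} → ℤ → Fin n
residue n x = fromℕ< (n%ℕd<d x n)

∣residue[x]-x : ∀ n .{{_ : NonZero n}} x → + n ∣ + toℕ (residue n x) - x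
∣residue[x]-x n x rewrite toℕ-fromℕ< (n%ℕd<d x n) = divides (- (x /ℕ n)) (begin
  + r - x                       ≡⟨ cong (λ y → + r - y) (a≡a%ℕn+[a/ℕn]*n x n) ⟩
  + r - (+ r ℤ.+ q ℤ.* + n)     ≡⟨ cancel (+ r) q (+ n) ⟩
  - q ℤ.* + n                   ∎)
  where
  open ≡-Reasoning
  r = x %ℕ n
  q = x /ℕ n
  cancel : ∀ r q n → r - (r ℤ.+ q ℤ.* n) ≡ - q ℤ.* n
  cancel = solve-∀

coords : ∀ {n d} → Cell n d → Fin d → ℤ
coords p i = + toℕ (p i)

OnBinaryHyperplane : ∀ {n d} → Cell n d → Set
OnBinaryHyperplane {n} p = + n ∣ binary (coords p)

attack-on-binary-hyperplane⇒≗ : ∀ {n d} {p q : Cell n d} → Coprime n ((2 ^ d) !) →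
  OnBinaryHyperplane p → OnBinaryHyperplane q → Attacks p q → p ≗ q
attack-on-binary-hyperplane⇒≗ {n} {p = p} {q} cop p∈H q∈H (c , v , v≢0 , q-p≡cv) i =
  sym (∣toℕ-toℕ⇒≡ (q i) (p i) (n∣q-p i))
  where
  n∣q-p-cv : ∀ i → + n ∣ coords q i - coords p i - c ℤ.* signℤ (v i)
  n∣q-p-cv i = ∣ᵤ⇒∣ (q-p≡cv i)
  Q = binary (coords q); P = binary (coords p); M = binary (signℤ ∘ v)
  n∣Q-P-cM : + n ∣ Q - P - c ℤ.* M
  n∣Q-P-cM = subst (+ n ∣_) (binary-combination (coords q) (coords p) (signℤ ∘ v) c) (∣-binary n∣q-p-cv)
  split : ∀ Q P cM → cM ≡ (Q - P) - (Q - P - cM)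
  split = solve-∀
  n∣c : + n ∣ c
  n∣c = ∣c*binary-signs⇒∣c v cop v≢0
    (subst (+ n ∣_) (sym (split Q P (c ℤ.* M))) (∣m∣n⇒∣m-n (∣m∣n⇒∣m-n q∈H p∈H) n∣Q-P-cM))
  add-back : ∀ x cv → x ≡ (x - cv) ℤ.+ cv
  add-back = solve-∀
  n∣q-p : ∀ i → + n ∣ coords q i - coords p i
  n∣q-p i = subst (+ n ∣_) (sym (add-back _ _)) (∣m∣n⇒∣m+n (n∣q-p-cv i) (∣m⇒∣m*n (signℤ (v i)) n∣c))

funToFin-cong : ∀ {m n} {f g : Fin m → Fin n} → f ≗ g → funToFin f ≡ funToFin g
funToFin-cong {ℕ.zero} _   = refl
funToFin-cong {suc m}  f≗g = cong₂ combine (f≗g zero) (funToFin-cong (f≗g ∘ suc))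

finToFun-injective : ∀ {m n} {a b : Fin (n ^ m)} → finToFun {n} {m} a ≗ finToFun b → a ≡ b
finToFun-injective {m} {n} {a} {b} a≗b = begin
  a                             ≡⟨ funToFin-finToFin {m} {n} a ⟨
  funToFin (finToFun {n} {m} a) ≡⟨ funToFin-cong a≗b ⟩
  funToFin (finToFun {n} {m} b) ≡⟨ funToFin-finToFin {m} {n} b ⟩
  b                             ∎
  where open ≡-Reasoning

-- The free coordinates x₁,…,x_k are the base-n digits of the index; x₀ is solved from the hyperplane equation.
binaryQueen : ∀ {n} k .{{_ : NonZero n}} → Fin (n ^ k) → Cell n (suc k)
binaryQueen {n} k a zero    = residue n (- (+ 2 ℤ.* binary (coords (finToFun {n} {k} a))))
binaryQueen {n} k a (suc i) = finToFun {n} {k} a i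

binaryQueen-injective : ∀ {n} k .{{_ : NonZero n}} {a b : Fin (n ^ k)} → binaryQueen k a ≗ binaryQueen k b → a ≡ b
binaryQueen-injective k a≗b = finToFun-injective (a≗b ∘ suc)

binaryQueen-onBinaryHyperplane : ∀ {n} k .{{_ : NonZero n}} (a : Fin (n ^ k)) → OnBinaryHyperplane (binaryQueen k a)
binaryQueen-onBinaryHyperplane {n} k a =
  subst (+ n ∣_) (cong (ℤ._+_ (coords (binaryQueen k a) zero)) (ℤ.neg-involutive 2B)) (∣residue[x]-x n (- 2B))
  where 2B = + 2 ℤ.* binary (coords (finToFun {n} {k} a))

corollary8p2 : (n d : ℕ) → 1 ≤ n → 1 ≤ d →
    gcd n ((2 ^ d) !) ≡ 1 →
    NonattackingPlacement n d (n ^ (d ∸ 1))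
corollary8p2 (suc n) (suc k) _ _ gcd≡1 = binaryQueen k , nonattacking
  where
  nonattacking : ∀ a b → a ≢ b → binaryQueen k a ≢ binaryQueen k b × ¬ Attacks (binaryQueen k a) (binaryQueen k b)
  nonattacking a b a≢b =
    a≢b ∘ binaryQueen-injective k ∘ cong-app ,
    a≢b ∘ binaryQueen-injective k ∘ attack-on-binary-hyperplane⇒≗ (gcd≡1⇒coprime gcd≡1)
      (binaryQueen-onBinaryHyperplane k a) (binaryQueen-onBinaryHyperplane k b)
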